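{- Let $T$ be a tetragonal graph with $|V(T)|=2m$, and let $u,v$ be two distinct vertices of $T$ with $\mathrm{dist}_{\partial T}(u,v)=d$. Then $T$ contains a $(u,v)$-path of length $\ell$ for every $\ell\in\{d,d+2,\dots,2m-d\}$.
   Context: A tetragonal graph is a graph $T$ together with a Hamiltonian cycle $\partial T$ (its boundary cycle), obtained as the last term $T_n$ of a sequence $T_2,\dots,T_n$ where $T_2\cong C_4$ with $\partial T_2=T_2$, and for $2\le i\le n-1$, $T_{i+1}$ is obtained from $T_i$ by adding two new vertices $x_i,y_i$ and the path $a_ix_iy_ib_i$ for some edge $a_ib_i\in E(\partial T_i)$, with $\partial T_{i+1}$ obtained from $\partial T_i$ by adding this path and deleting the edge $a_ib_i$; $\partial T=\partial T_n$. $\mathrm{dist}_{\partial T}(u,v)$ is the distance between $u$ and $v$ along the cycle $\partial T$. -}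

module Defs where

open import Data.Nat using (ℕ; zero; suc; _+_; _*_; _∸_; _≤_; _⊓_; ∣_-_∣)
open import Data.Fin using (Fin; zero; suc; toℕ)
open import Data.List using (List; []; _∷_; length; lookup; last; _++_)
open import Data.List.Membership.Propositional using (_∈_)
open import Data.List.Relation.Unary.Unique.Propositional using (Unique)
open import Data.Maybe using (Maybe; just)
open import Data.Product using (_×_; _,_; Σ; ∃)
open import Data.Sum using (_⊎_)
open import Data.Unit using (⊤)
open import Relation.Binary.PropositionalEquality using (_≡_)

-- Vertices are natural numbers.  The boundary cycle is a list of the vertices
-- in cyclic order (the last vertex is adjacent on the cycle to the first).

cycNextAux : ℕ → (xs : List ℕ) → Fin (length xs) → ℕ
cycNextAux first (x ∷ [])     zero    = first
cycNextAux first (x ∷ y ∷ xs) zero    = y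
cycNextAux first (x ∷ xs)     (suc k) = cycNextAux first xs k

cycNext : (xs : List ℕ) → Fin (length xs) → ℕ
cycNext (x ∷ xs) k = cycNextAux x (x ∷ xs) k

insertAfter : (xs : List ℕ) → Fin (length xs) → ℕ → ℕ → List ℕ
insertAfter (x ∷ xs) zero    p q = x ∷ p ∷ q ∷ xs
insertAfter (x ∷ xs) (suc k) p q = x ∷ insertAfter xs k p q

-- Tetragonal graphs, given by their construction sequence.
-- base = T_2 = C_4 on 0,1,2,3 with boundary 0-1-2-3-0.
-- grow T k : the boundary edge a b with a = k-th boundary vertex, b its cyclic
-- successor, gets the path a x y b with fresh x = |V(T)|, y = |V(T)|+1;
-- the boundary replaces the edge a b by a x y b (the edge a b stays in T).
mutual
  data Tet : Set where
    base : Tet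
    grow : (T : Tet) → Fin (length (boundary T)) → Tet

  boundary : Tet → List ℕ
  boundary base = 0 ∷ 1 ∷ 2 ∷ 3 ∷ []
  boundary (grow T k) =
    insertAfter (boundary T) k (length (boundary T)) (suc (length (boundary T)))

edges : Tet → List (ℕ × ℕ)
edges base = (0 , 1) ∷ (1 , 2) ∷ (2 , 3) ∷ (3 , 0) ∷ []
edges (grow T k) =
  (lookup (boundary T) k , length (boundary T))
  ∷ (length (boundary T) , suc (length (boundary T)))
  ∷ (suc (length (boundary T)) , cycNext (boundary T) k)
  ∷ edges T

-- number of vertices |V(T)| (the boundary is a Hamiltonian cycle)
order : Tet → ℕ
order T = length (boundary T)

Adj : Tet → ℕ → ℕ → Set
Adj T x y = ((x , y) ∈ edges T) ⊎ ((y , x) ∈ edges T)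

WalkFrom : Tet → ℕ → List ℕ → Set
WalkFrom T u []       = ⊤
WalkFrom T u (w ∷ ws) = Adj T u w × WalkFrom T w ws

HasPath : Tet → ℕ → ℕ → ℕ → Set
HasPath T u v ℓ = Σ (List ℕ) λ ws →
  length ws ≡ ℓ × WalkFrom T u ws × Unique (u ∷ ws) × last (u ∷ ws) ≡ just v

distBd : (T : Tet) → Fin (order T) → Fin (order T) → ℕ
distBd T i j = ∣ toℕ i - toℕ j ∣ ⊓ (order T ∸ ∣ toℕ i - toℕ j ∣)

-- Induct along the construction, keeping the invariant that whenever two boundary vertices
-- u ≠ v cut the boundary cycle into arcs of lengths a and b, there is a (u,v)-path of every
-- length between a and b of their common parity.  The two extreme lengths are the arcs
-- themselves, and as the boundary has even length every other length is at least 2 away from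
-- both.  When the ear α x y β is attached along the boundary edge α β, a pair of old vertices
-- sees one of its arcs grow by 2, so its non-extreme lengths were already realised in the old
-- graph; a pair with a new endpoint is served by an old path from α or β prolonged by one or
-- two of x, y.

module Submission where

open import Defs
open import Data.Nat using (ℕ; zero; suc; _+_; _*_; _∸_; _≤_; _<_; z≤n; s≤s; s≤s⁻¹; _⊓_; _⊔_; ∣_-_∣)
open import Data.Nat.Properties
open import Data.Nat.Tactic.RingSolver using (solve-∀)
open import Data.Fin using (Fin; zero; suc; toℕ)
open import Data.Fin.Properties using (toℕ-injective; toℕ<n)
open import Data.List using (List; []; _∷_; _++_; _∷ʳ_; _ʳ++_; length; lookup; head; last; reverse; drop)
open import Data.List.Properties
  using (length-++; ++-assoc; ++-identityʳ; ∷-injectiveˡ; ∷-injectiveʳ; ∷ʳ-++; unfold-reverse;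
         reverse-involutive; length-reverse)
open import Data.List.Relation.Unary.Any using (here; there)
open import Data.List.Relation.Unary.All as All using (All; []; _∷_)
import Data.List.Relation.Unary.All.Properties as All
open import Data.List.Relation.Unary.AllPairs using ([]; _∷_)
open import Data.List.Relation.Unary.Unique.Propositional using (Unique)
open import Data.List.Relation.Unary.Unique.DecPropositional _≟_ using (unique?)
import Data.List.Relation.Binary.Permutation.Setoid as Perm
import Data.List.Relation.Binary.Permutation.Setoid.Properties as PermProps
open import Data.Maybe using (just)
open import Data.Maybe.Properties using (just-injective)
open import Data.Product using (∃; ∃₂; ∃-syntax; _×_; _,_; proj₁; proj₂)
open import Data.Sum using (_⊎_; inj₁; inj₂; [_,_]; swap)
open import Data.Unit using (⊤; tt)
open import Data.Empty using (⊥-elim)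
open import Function using (_∘_)
open import Level using (0ℓ)
open import Relation.Binary using (tri<; tri≈; tri>)
open import Relation.Binary.PropositionalEquality
  using (_≡_; _≢_; refl; sym; trans; cong; cong₂; subst; subst₂; resp; setoid; module ≡-Reasoning)
open import Relation.Nullary.Decidable using (toWitness; toWitnessFalse; _×-dec_)
open import Relation.Unary using (Pred; U; ｛_｝; _∪_; _∉_)

private
  module ↭  = Perm (setoid ℕ)
  module ↭ₚ = PermProps (setoid ℕ)

record RotationInvariant (Φ : List ℕ → Set) : Set where
  field
    rotateʳ : ∀ L x → Φ (L ∷ʳ x) → Φ (x ∷ L)

open RotationInvariant

++-swap : ∀ {Φ} → RotationInvariant Φ → ∀ A B → Φ (A ++ B) → Φ (B ++ A)
++-swap {Φ} rot A []      φ = subst Φ (++-identityʳ A) φ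
++-swap {Φ} rot A (b ∷ B) φ =
  rot .rotateʳ (B ++ A) b
    (subst Φ (sym (++-assoc B A (b ∷ []))) (++-swap rot (A ∷ʳ b) B (subst Φ (sym (∷ʳ-++ A b B)) φ)))

length-∷ʳ : ∀ (xs : List ℕ) x → length (xs ∷ʳ x) ≡ suc (length xs)
length-∷ʳ []       x = refl
length-∷ʳ (y ∷ xs) x = cong suc (length-∷ʳ xs x)

length-++-comm : ∀ (xs ys : List ℕ) → length (xs ++ ys) ≡ length (ys ++ xs)
length-++-comm xs ys =
  trans (length-++ xs) (trans (+-comm (length xs) (length ys)) (sym (length-++ ys)))

last-∷ʳ : ∀ (xs : List ℕ) x → last (xs ∷ʳ x) ≡ just x
last-∷ʳ []           x = refl
last-∷ʳ (y ∷ [])     x = refl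
last-∷ʳ (y ∷ z ∷ xs) x = last-∷ʳ (z ∷ xs) x

last-reverse : ∀ (xs : List ℕ) → last (reverse xs) ≡ head xs
last-reverse []       = refl
last-reverse (x ∷ xs) = trans (cong last (unfold-reverse x xs)) (last-∷ʳ (reverse xs) x)

head-reverse : ∀ (xs : List ℕ) → head (reverse xs) ≡ last xs
head-reverse xs = trans (sym (last-reverse (reverse xs))) (cong last (reverse-involutive xs))

length-rotation : ∀ n → RotationInvariant (λ L → length L ≡ n)
length-rotation n .rotateʳ L x len = trans (sym (length-∷ʳ L x)) len

All-rotation : ∀ {P : Pred ℕ 0ℓ} → RotationInvariant (All P)
All-rotation .rotateʳ L x ps with ps′ , px ∷ [] ← All.++⁻ L ps = px ∷ ps′

All-reverse : ∀ {P : Pred ℕ 0ℓ} xs → All P xs → All P (reverse xs)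
All-reverse {P} xs = ↭ₚ.All-resp-↭ (resp P) (↭.↭-sym (↭ₚ.↭-reverse xs))

Unique-rotation : RotationInvariant Unique
Unique-rotation .rotateʳ L x = ↭ₚ.Unique-resp-↭ (↭ₚ.++-comm L (x ∷ []))

Unique-reverse : ∀ xs → Unique xs → Unique (reverse xs)
Unique-reverse xs = ↭ₚ.Unique-resp-↭ (↭.↭-sym (↭ₚ.↭-reverse xs))

Unique-++⁻ˡ : ∀ (xs : List ℕ) {ys} → Unique (xs ++ ys) → Unique xs
Unique-++⁻ˡ []       _        = []
Unique-++⁻ˡ (x ∷ xs) (x∉ ∷ u) = All.++⁻ˡ xs x∉ ∷ Unique-++⁻ˡ xs u

Adj-sym : ∀ {T p q} → Adj T p q → Adj T q p
Adj-sym = swap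

Chain : Tet → List ℕ → Set
Chain T []       = ⊤
Chain T (x ∷ xs) = WalkFrom T x xs

ClosedWalk : Tet → List ℕ → Set
ClosedWalk T []       = ⊤
ClosedWalk T (x ∷ xs) = WalkFrom T x (xs ∷ʳ x)

Cycle : Tet → List ℕ → Set
Cycle T L = ClosedWalk T L × Unique L

WalkFrom-map : ∀ {T T′} → (∀ {p q} → Adj T p q → Adj T′ p q) →
  ∀ {u} ws → WalkFrom T u ws → WalkFrom T′ u ws
WalkFrom-map f []       _       = tt
WalkFrom-map f (w ∷ ws) (a , w⃗) = f a , WalkFrom-map f ws w⃗

WalkFrom-++⁻ : ∀ {T u} xs {w ys} → WalkFrom T u (xs ++ w ∷ ys) →
  WalkFrom T u (xs ∷ʳ w) × WalkFrom T w ys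
WalkFrom-++⁻ []       (a , w⃗) = (a , tt) , w⃗
WalkFrom-++⁻ (x ∷ xs) (a , w⃗) with w⃗₁ , w⃗₂ ← WalkFrom-++⁻ xs w⃗ = (a , w⃗₁) , w⃗₂

WalkFrom-ʳ++ : ∀ {T x} xs {acc} → WalkFrom T x xs → WalkFrom T x acc → Chain T (xs ʳ++ x ∷ acc)
WalkFrom-ʳ++ []       _       w⃗′ = w⃗′
WalkFrom-ʳ++ (y ∷ ys) (a , w⃗) w⃗′ = WalkFrom-ʳ++ ys w⃗ (Adj-sym a , w⃗′)

Chain-reverse : ∀ {T} xs → Chain T xs → Chain T (reverse xs)
Chain-reverse []       _ = tt
Chain-reverse (x ∷ xs) w⃗ = WalkFrom-ʳ++ xs w⃗ tt

ClosedWalk-rotation : ∀ {T} → RotationInvariant (ClosedWalk T)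
ClosedWalk-rotation .rotateʳ []      x w⃗ = w⃗
ClosedWalk-rotation .rotateʳ (y ∷ L) x w⃗
  with w⃗₁ , (a , tt) ← WalkFrom-++⁻ L (subst (WalkFrom _ y) (++-assoc L (x ∷ []) (y ∷ [])) w⃗) =
  a , w⃗₁

Cycle-rotation : ∀ {T} → RotationInvariant (Cycle T)
Cycle-rotation .rotateʳ L x (w⃗ , u) =
  ClosedWalk-rotation .rotateʳ L x w⃗ , Unique-rotation .rotateʳ L x u

-- P over-approximates the vertex set, so that any vertex outside P can be attached at an end.
record Path (T : Tet) (P : Pred ℕ 0ℓ) (u v ℓ : ℕ) : Set where
  constructor path
  field
    vertices : List ℕ
    chain    : Chain T vertices
    unique   : Unique vertices
    within   : All P vertices
    head≡    : head vertices ≡ just u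
    last≡    : last vertices ≡ just v
    length≡  : length vertices ≡ suc ℓ

open Path

module _ {T : Tet} {P : Pred ℕ 0ℓ} where

  Path-reverse : ∀ {u v ℓ} → Path T P u v ℓ → Path T P v u ℓ
  Path-reverse p = record
    { vertices = reverse (vertices p)
    ; chain    = Chain-reverse (vertices p) (chain p)
    ; unique   = Unique-reverse (vertices p) (unique p)
    ; within   = All-reverse (vertices p) (within p)
    ; head≡    = trans (head-reverse (vertices p)) (last≡ p)
    ; last≡    = trans (last-reverse (vertices p)) (head≡ p)
    ; length≡  = trans (length-reverse (vertices p)) (length≡ p)
    }

  Path-cons : ∀ {z u v ℓ} → z ∉ P → Adj T z u → Path T P u v ℓ →
    Path T (｛ z ｝ ∪ P) z v (suc ℓ)
  Path-cons {z} z∉P a (path (u ∷ ws) w⃗ un ps refl l len) =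
    path (z ∷ u ∷ ws) (a , w⃗) (All.map z≢ ps ∷ un) (inj₁ refl ∷ All.map inj₂ ps) refl l
         (cong suc len)
    where
    z≢ : ∀ {w} → P w → z ≢ w
    z≢ Pw refl = z∉P Pw

  WalkFrom-All : (∀ {p q} → Adj T p q → P q) → ∀ {u} ws → WalkFrom T u ws → All P ws
  WalkFrom-All adj⇒P []       _       = []
  WalkFrom-All adj⇒P (w ∷ ws) (a , w⃗) = adj⇒P a ∷ WalkFrom-All adj⇒P ws w⃗

  HasPath⇒Path : ∀ {u v ℓ} → (∀ {p q} → Adj T p q → P q) → P u →
    HasPath T u v ℓ → Path T P u v ℓ
  HasPath⇒Path {u} adj⇒P Pu (ws , len , w⃗ , un , l) =
    path (u ∷ ws) w⃗ un (Pu ∷ WalkFrom-All adj⇒P ws w⃗) refl l (cong suc len)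

  Path⇒HasPath : ∀ {u v ℓ} → Path T P u v ℓ → HasPath T u v ℓ
  Path⇒HasPath (path (u ∷ ws) w⃗ un _ refl l len) = ws , suc-injective len , w⃗ , un , l

Path-snoc : ∀ {T P z u v ℓ} → z ∉ P → Adj T v z → Path T P u v ℓ →
  Path T (｛ z ｝ ∪ P) u z (suc ℓ)
Path-snoc z∉P a = Path-reverse ∘ Path-cons z∉P (Adj-sym a) ∘ Path-reverse

Path-map : ∀ {T T′ P u v ℓ} → (∀ {p q} → Adj T p q → Adj T′ p q) →
  Path T P u v ℓ → Path T′ P u v ℓ
Path-map {T} {T′} f p =
  path (vertices p) (Chain-map (vertices p) (chain p)) (unique p) (within p)
       (head≡ p) (last≡ p) (length≡ p)
  where
  Chain-map : ∀ xs → Chain T xs → Chain T′ xs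
  Chain-map []       _ = tt
  Chain-map (x ∷ xs) w⃗ = WalkFrom-map f xs w⃗

HasPath-reverse : ∀ {T u v ℓ} → HasPath T u v ℓ → HasPath T v u ℓ
HasPath-reverse = Path⇒HasPath ∘ Path-reverse ∘ HasPath⇒Path {P = U} _ tt

Cycle-arc : ∀ {T u} Q {v R} → Cycle T (u ∷ Q ++ v ∷ R) → Path T U u v (suc (length Q))
Cycle-arc {T} {u} Q {v} {R} (w⃗ , un) =
  path (u ∷ Q ∷ʳ v) arc unique′ (All.universal (λ _ → tt) _) refl (last-∷ʳ (u ∷ Q) v)
       (cong suc (length-∷ʳ Q v))
  where
  arc : WalkFrom T u (Q ∷ʳ v)
  arc = proj₁ (WalkFrom-++⁻ Q (subst (WalkFrom T u) (++-assoc Q (v ∷ R) (u ∷ [])) w⃗))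
  unique′ : Unique (u ∷ Q ∷ʳ v)
  unique′ = Unique-++⁻ˡ (u ∷ Q ∷ʳ v) (subst Unique (cong (u ∷_) (sym (++-assoc Q (v ∷ []) R))) un)

Cycle-decomposition : ∀ {T L} P {u} Q {v} S → Cycle T L → L ≡ P ++ u ∷ Q ++ v ∷ S →
  Cycle T (u ∷ Q ++ v ∷ S ++ P)
Cycle-decomposition {T} P {u} Q {v} S cycle eq =
  subst (Cycle T) (cong (u ∷_) (++-assoc Q (v ∷ S) P))
    (++-swap Cycle-rotation P (u ∷ Q ++ v ∷ S) (subst (Cycle T) eq cycle))

Ladder : ℕ → ℕ → ℕ → Set
Ladder a b ℓ = ∃[ t ] ℓ ≡ a + 2 * t × ℓ ≤ b

InnerLadder : ℕ → ℕ → ℕ → Set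
InnerLadder a b ℓ = ∃[ t ] ℓ ≡ 2 + a + 2 * t × 2 + ℓ ≤ b

Between : ℕ → ℕ → ℕ → Set
Between a b ℓ = Ladder a b ℓ ⊎ Ladder b a ℓ

StrictlyBetween : ℕ → ℕ → ℕ → Set
StrictlyBetween a b ℓ = InnerLadder a b ℓ ⊎ InnerLadder b a ℓ

private
  ladder-step : ∀ a t → a + 2 * suc t ≡ 2 + a + 2 * t
  ladder-step = solve-∀

  odd-sum : ∀ a t → a + suc (a + 2 * suc t) ≡ suc (2 * (a + suc t))
  odd-sum = solve-∀

ladder-trichotomy : ∀ m {a b ℓ} → a + b ≡ 2 * m → Ladder a b ℓ →
  ℓ ≡ a ⊎ ℓ ≡ b ⊎ InnerLadder a b ℓ
ladder-trichotomy m {a} _ (zero , refl , _) = inj₁ (+-identityʳ a)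
ladder-trichotomy m {a} {b} a+b≡ (suc t , refl , ℓ≤b) with m≤n⇒m<n∨m≡n ℓ≤b
... | inj₂ ℓ≡b = inj₂ (inj₁ ℓ≡b)
... | inj₁ ℓ<b with m≤n⇒m<n∨m≡n ℓ<b
...   | inj₁ 1+ℓ<b = inj₂ (inj₂ (t , ladder-step a t , 1+ℓ<b))
...   | inj₂ 1+ℓ≡b = ⊥-elim (even≢odd m (a + suc t) (begin
  2 * m                    ≡⟨ sym a+b≡ ⟩
  a + b                    ≡⟨ cong (a +_) (sym 1+ℓ≡b) ⟩
  a + suc (a + 2 * suc t)  ≡⟨ odd-sum a t ⟩
  suc (2 * (a + suc t))    ∎))
  where open ≡-Reasoning

between-trichotomy : ∀ m {a b ℓ} → a + b ≡ 2 * m → Between a b ℓ →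
  ℓ ≡ a ⊎ ℓ ≡ b ⊎ StrictlyBetween a b ℓ
between-trichotomy m a+b≡ (inj₁ l) with ladder-trichotomy m a+b≡ l
... | inj₁ ℓ≡a          = inj₁ ℓ≡a
... | inj₂ (inj₁ ℓ≡b)   = inj₂ (inj₁ ℓ≡b)
... | inj₂ (inj₂ inner) = inj₂ (inj₂ (inj₁ inner))
between-trichotomy m {a} {b} a+b≡ (inj₂ l) with ladder-trichotomy m (trans (+-comm b a) a+b≡) l
... | inj₁ ℓ≡b          = inj₂ (inj₁ ℓ≡b)
... | inj₂ (inj₁ ℓ≡a)   = inj₁ ℓ≡a
... | inj₂ (inj₂ inner) = inj₂ (inj₂ (inj₂ inner))

strictlyBetween-drop : ∀ {a b ℓ} → StrictlyBetween a (2 + b) ℓ → Between a b ℓ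
strictlyBetween-drop {a} (inj₁ (t , refl , h)) =
  inj₁ (suc t , sym (ladder-step a t) , ≤-pred (≤-pred h))
strictlyBetween-drop {b = b} (inj₂ (t , refl , h)) =
  inj₂ (2 + t , sym (trans (ladder-step b (suc t)) (cong (2 +_) (ladder-step b t))) , m+n≤o⇒n≤o 2 h)

strictlyBetween-dropˡ : ∀ {a b ℓ} → StrictlyBetween (2 + a) b ℓ → Between a b ℓ
strictlyBetween-dropˡ = swap ∘ strictlyBetween-drop ∘ swap

strictlyBetween-pred : ∀ {a b ℓ} → StrictlyBetween (suc a) (suc b) ℓ →
  ∃[ ℓ′ ] ℓ ≡ suc ℓ′ × Between a b ℓ′
strictlyBetween-pred {a} (inj₁ (t , refl , h)) =
  _ , refl , inj₁ (suc t , sym (ladder-step a t) , m+n≤o⇒n≤o 2 (≤-pred h))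
strictlyBetween-pred {b = b} (inj₂ (t , refl , h)) =
  _ , refl , inj₂ (suc t , sym (ladder-step b t) , m+n≤o⇒n≤o 2 (≤-pred h))

strictlyBetween-shift : ∀ {a b ℓ} → StrictlyBetween a (2 + b) ℓ →
  ∃[ ℓ′ ] ℓ ≡ 2 + ℓ′ × Between a b ℓ′
strictlyBetween-shift (inj₁ (t , refl , h)) =
  _ , refl , inj₁ (t , refl , m+n≤o⇒n≤o 2 (≤-pred (≤-pred h)))
strictlyBetween-shift {b = b} (inj₂ (t , refl , h)) =
  _ , refl , inj₂ (suc t , sym (ladder-step b t) , m+n≤o⇒n≤o 4 h)

innerLadder-sum : ∀ {a b ℓ} → InnerLadder (suc a) (suc b) ℓ → 6 ≤ suc a + suc b
innerLadder-sum {a} {b} (t , refl , h) = begin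
  6              ≤⟨ m≤m+n 6 a ⟩
  suc (5 + a)    ≤⟨ s≤s (m+n≤o⇒m≤o (5 + a) h) ⟩
  1 + suc b      ≤⟨ +-monoˡ-≤ (suc b) (s≤s z≤n) ⟩
  suc a + suc b  ∎
  where open ≤-Reasoning

strictlyBetween-sum : ∀ {a b ℓ} → StrictlyBetween (suc a) (suc b) ℓ → 6 ≤ suc a + suc b
strictlyBetween-sum (inj₁ inner)         = innerLadder-sum inner
strictlyBetween-sum {a} {b} (inj₂ inner) =
  ≤-trans (innerLadder-sum inner) (≤-reflexive (+-comm (suc b) (suc a)))

between-min : ∀ {a b} t → a ⊓ b + 2 * t ≤ a ⊔ b → Between a b (a ⊓ b + 2 * t)
between-min {a} {b} t h with ≤-total a b
... | inj₁ a≤b rewrite m≤n⇒m⊓n≡m a≤b | m≤n⇒m⊔n≡n a≤b = inj₁ (t , refl , h)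
... | inj₂ b≤a rewrite m≥n⇒m⊓n≡n b≤a | m≥n⇒m⊔n≡m b≤a = inj₂ (t , refl , h)

between-distance : ∀ {d N} t → d ≤ N → d ⊓ (N ∸ d) + 2 * t ≤ N ∸ d ⊓ (N ∸ d) →
  Between d (N ∸ d) (d ⊓ (N ∸ d) + 2 * t)
between-distance {d} {N} t d≤N h = between-min t (subst (d ⊓ (N ∸ d) + 2 * t ≤_) N∸min≡max h)
  where
  N∸min≡max : N ∸ d ⊓ (N ∸ d) ≡ d ⊔ (N ∸ d)
  N∸min≡max with ≤-total d (N ∸ d)
  ... | inj₁ d≤b rewrite m≤n⇒m⊓n≡m d≤b | m≤n⇒m⊔n≡n d≤b = refl
  ... | inj₂ b≤d rewrite m≥n⇒m⊓n≡n b≤d | m≥n⇒m⊔n≡m b≤d = m∸[m∸n]≡n d≤N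

-- u and v cut the cyclic sequence L into two arcs, of lengths suc |Q| and suc |P ++ S|.
ArcPaths : (ℕ → ℕ → ℕ → Set) → Tet → List ℕ → Set
ArcPaths R T L = ∀ P u Q v S → L ≡ P ++ u ∷ Q ++ v ∷ S →
  ∀ {ℓ} → R (suc (length Q)) (suc (length (P ++ S))) ℓ → HasPath T u v ℓ

private
  arcs-sum : ∀ p q s → suc q + suc (p + s) ≡ p + suc (q + suc s)
  arcs-sum = solve-∀

length-decomposition : ∀ {L : List ℕ} P {u} Q {v} S → L ≡ P ++ u ∷ Q ++ v ∷ S →
  suc (length Q) + suc (length (P ++ S)) ≡ length L
length-decomposition P {u} Q {v} S refl = begin
  suc (length Q) + suc (length (P ++ S))      ≡⟨ cong (λ s → suc (length Q) + suc s) (length-++ P) ⟩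
  suc (length Q) + suc (length P + length S)  ≡⟨ arcs-sum (length P) (length Q) (length S) ⟩
  length P + suc (length Q + suc (length S))  ≡⟨ cong (λ s → length P + suc s) (length-++ Q) ⟨
  length P + length (u ∷ Q ++ v ∷ S)          ≡⟨ length-++ P ⟨
  length (P ++ u ∷ Q ++ v ∷ S)                ∎
  where open ≡-Reasoning

∷ʳ-decomposition : ∀ P (u : ℕ) Q v S x →
  (P ++ u ∷ Q ++ v ∷ S) ∷ʳ x ≡ P ++ u ∷ Q ++ v ∷ (S ∷ʳ x)
∷ʳ-decomposition P u Q v S x = trans (++-assoc P (u ∷ Q ++ v ∷ S) (x ∷ []))
  (cong (λ R → P ++ u ∷ R) (++-assoc Q (v ∷ S) (x ∷ [])))

ArcPaths-rotation : ∀ {T} → RotationInvariant (ArcPaths Between T)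
ArcPaths-rotation .rotateʳ L x paths [] u Q v S eq {ℓ} between with refl ← ∷-injectiveˡ eq =
  HasPath-reverse
    (paths Q v S u [] L∷ʳx≡ (subst (λ q → Between _ (suc q) ℓ) (sym Q++[]≡) (swap between)))
  where
  L∷ʳx≡ : L ∷ʳ x ≡ Q ++ v ∷ S ∷ʳ x
  L∷ʳx≡ = trans (cong (_∷ʳ x) (∷-injectiveʳ eq)) (++-assoc Q (v ∷ S) (x ∷ []))
  Q++[]≡ : length (Q ++ []) ≡ length Q
  Q++[]≡ = cong length (++-identityʳ Q)
ArcPaths-rotation .rotateʳ L x paths (_ ∷ P) u Q v S eq {ℓ} between with refl ← ∷-injectiveˡ eq =
  paths P u Q v (S ∷ʳ x) L∷ʳx≡ (subst (λ s → Between _ (suc s) ℓ) (sym outer≡) between)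
  where
  L∷ʳx≡ : L ∷ʳ x ≡ P ++ u ∷ Q ++ v ∷ S ∷ʳ x
  L∷ʳx≡ = trans (cong (_∷ʳ x) (∷-injectiveʳ eq)) (∷ʳ-decomposition P u Q v S x)
  outer≡ : length (P ++ S ∷ʳ x) ≡ suc (length (P ++ S))
  outer≡ = trans (cong length (sym (++-assoc P S (x ∷ [])))) (length-∷ʳ (P ++ S) x)

ArcPaths-fromStrict : ∀ {T L} m → Cycle T L → length L ≡ 2 * m →
  ArcPaths StrictlyBetween T L → ArcPaths Between T L
ArcPaths-fromStrict {T} m cycle even strict P u Q v S eq between
  with between-trichotomy m (trans (length-decomposition P Q S eq) even) between
... | inj₁ refl            = Path⇒HasPath (Cycle-arc Q (Cycle-decomposition P Q S cycle eq))
... | inj₂ (inj₁ refl)     =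
  subst (λ s → HasPath T u v (suc s)) (length-++-comm S P)
    (HasPath-reverse (Path⇒HasPath (Cycle-arc (S ++ P) cycleᵥ)))
  where
  cycleᵥ : Cycle T (v ∷ (S ++ P) ++ u ∷ Q)
  cycleᵥ = ++-swap Cycle-rotation (u ∷ Q) (v ∷ S ++ P) (Cycle-decomposition P Q S cycle eq)
... | inj₂ (inj₂ strictly) = strict P u Q v S eq strictly

-- The ear α x y β with fresh x = n and y = suc n, attached along the edge α β of α ∷ β ∷ Mid.
module Ear {T T′ : Tet} {n α β : ℕ} {Mid : List ℕ}
  (lift : ∀ {p q} → Adj T p q → Adj T′ p q)
  (αx : Adj T′ α n) (xy : Adj T′ n (suc n)) (yβ : Adj T′ (suc n) β)
  (adj-below : ∀ {p q} → Adj T p q → q < n)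
  (cycle-below : All (_< n) (α ∷ β ∷ Mid))
  where

  x∉ : n ∉ (_< n)
  x∉ = n≮n n

  y∉ : suc n ∉ (_< n)
  y∉ = <-asym (n<1+n n)

  x∉′ : n ∉ (｛ suc n ｝ ∪ (_< n))
  x∉′ = [ 1+n≢n , x∉ ]

  y∉′ : suc n ∉ (｛ n ｝ ∪ (_< n))
  y∉′ = [ 1+n≢n ∘ sym , y∉ ]

  Cycle-ear : Cycle T (α ∷ β ∷ Mid) → Cycle T′ (α ∷ n ∷ suc n ∷ β ∷ Mid)
  Cycle-ear ((_ , w⃗) , (α∉ ∷ unique)) = (αx , xy , yβ , WalkFrom-map lift (Mid ∷ʳ α) w⃗) , unique′
    where
    α<n : α < n
    α<n = All.head cycle-below
    rest<n : All (_< n) (β ∷ Mid)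
    rest<n = All.tail cycle-below
    unique′ : Unique (α ∷ n ∷ suc n ∷ β ∷ Mid)
    unique′ = (<⇒≢ α<n ∷ <⇒≢ (m<n⇒m<1+n α<n) ∷ α∉)
            ∷ (1+n≢n ∘ sym ∷ All.map >⇒≢ rest<n)
            ∷ All.map (>⇒≢ ∘ m<n⇒m<1+n) rest<n
            ∷ unique

  module _ (paths : ArcPaths Between T (α ∷ β ∷ Mid)) where

    oldPath : ∀ P {u} Q {v} S → α ∷ β ∷ Mid ≡ P ++ u ∷ Q ++ v ∷ S →
      ∀ {ℓ} → Between (suc (length Q)) (suc (length (P ++ S))) ℓ → Path T′ (_< n) u v ℓ
    oldPath P Q S eq between = Path-map lift (HasPath⇒Path adj-below u<n (paths P _ Q _ S eq between))
      where
      u<n : _ < n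
      u<n = All.head (All.++⁻ʳ P (subst (All (_< n)) eq cycle-below))

    oldPath-αβ : ∀ {ℓ} → Between 1 (suc (length Mid)) ℓ → Path T′ (_< n) α β ℓ
    oldPath-αβ = oldPath [] [] Mid refl

    -- The clauses treat the pairs (α,x) (α,y) (α,old) (x,y) (x,old) (y,β) (y,old) (old,old).
    StrictArcPaths-ear : ArcPaths StrictlyBetween T′ (α ∷ n ∷ suc n ∷ β ∷ Mid)
    StrictArcPaths-ear [] _ [] _ _ refl strictly
      with _ , refl , between ← strictlyBetween-shift strictly =
      Path⇒HasPath (Path-reverse (Path-cons x∉′ xy (Path-cons y∉ yβ (Path-reverse (oldPath-αβ between)))))
    StrictArcPaths-ear [] _ (_ ∷ []) _ _ refl strictly
      with _ , refl , between ← strictlyBetween-pred strictly =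
      Path⇒HasPath (Path-snoc y∉ (Adj-sym yβ) (oldPath-αβ between))
    StrictArcPaths-ear [] u (_ ∷ _ ∷ Q) v S eq strictly
      with refl ← ∷-injectiveˡ eq =
      Path⇒HasPath (oldPath [] Q S (cong (α ∷_) (cong (drop 3) eq)) (strictlyBetween-dropˡ strictly))
    StrictArcPaths-ear (_ ∷ []) _ [] _ _ refl strictly
      with _ , refl , between ← strictlyBetween-shift strictly =
      Path⇒HasPath (Path-snoc y∉′ (Adj-sym yβ) (Path-cons x∉ (Adj-sym αx) (oldPath-αβ between)))
    StrictArcPaths-ear (_ ∷ []) u (_ ∷ Q) v S eq strictly
      with refl ← ∷-injectiveˡ (cong (drop 1) eq) | _ , refl , between ← strictlyBetween-pred strictly =
      Path⇒HasPath (Path-cons x∉ (Adj-sym αx) (oldPath [] Q S (cong (α ∷_) (cong (drop 3) eq)) between))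
    StrictArcPaths-ear (_ ∷ _ ∷ []) _ [] _ _ refl strictly
      with _ , refl , between ← strictlyBetween-shift strictly =
      Path⇒HasPath (Path-cons y∉′ (Adj-sym xy) (Path-cons x∉ (Adj-sym αx) (oldPath-αβ between)))
    StrictArcPaths-ear (_ ∷ _ ∷ []) u (_ ∷ Q) v S eq strictly
      with refl ← ∷-injectiveˡ (cong (drop 2) eq) | _ , refl , between ← strictlyBetween-pred strictly =
      Path⇒HasPath (Path-cons y∉ yβ
        (oldPath (α ∷ []) Q S (cong (λ R → α ∷ β ∷ R) (cong (drop 4) eq)) between))
    StrictArcPaths-ear (_ ∷ _ ∷ _ ∷ P) u Q v S eq strictly =
      Path⇒HasPath (oldPath (α ∷ P) Q S (cong (α ∷_) (cong (drop 3) eq)) (strictlyBetween-drop strictly))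

    ArcPaths-ear : ∀ m → Cycle T (α ∷ β ∷ Mid) → length (α ∷ β ∷ Mid) ≡ 2 * m →
      ArcPaths Between T′ (α ∷ n ∷ suc n ∷ β ∷ Mid)
    ArcPaths-ear m cycle length≡ =
      ArcPaths-fromStrict (suc m) (Cycle-ear cycle) (trans (cong (2 +_) length≡) (sym (*-suc 2 m)))
        StrictArcPaths-ear

length-insertAfter : ∀ xs k p q → length (insertAfter xs k p q) ≡ 2 + length xs
length-insertAfter (x ∷ xs) zero    p q = refl
length-insertAfter (x ∷ xs) (suc k) p q = cong suc (length-insertAfter xs k p q)

insertAfter-split : ∀ f xs k p q → ∃₂ λ P S →
  xs ≡ P ++ lookup xs k ∷ S × insertAfter xs k p q ≡ P ++ lookup xs k ∷ p ∷ q ∷ S ×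
  just (cycNextAux f xs k) ≡ head (S ∷ʳ f)
insertAfter-split f (x ∷ [])     zero    p q = [] , [] , refl , refl , refl
insertAfter-split f (x ∷ y ∷ xs) zero    p q = [] , y ∷ xs , refl , refl , refl
insertAfter-split f (x ∷ y ∷ xs) (suc k) p q
  with P , S , xs≡ , ins≡ , next≡ ← insertAfter-split f (y ∷ xs) k p q =
  x ∷ P , S , cong (x ∷_) xs≡ , cong (x ∷_) ins≡ , next≡

insertAfter-rotation : ∀ xs k p q → 2 ≤ length xs → ∃₂ λ P S → ∃ λ Mid →
  xs ≡ P ++ lookup xs k ∷ S × insertAfter xs k p q ≡ P ++ lookup xs k ∷ p ∷ q ∷ S ×
  S ++ P ≡ cycNext xs k ∷ Mid
insertAfter-rotation (x ∷ xs) k p q 2≤ with insertAfter-split x (x ∷ xs) k p q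
... | [] , [] , xs≡ , _ , _ with s≤s () ← ≤-trans 2≤ (≤-reflexive (cong length xs≡))
... | [] , s ∷ S , xs≡ , ins≡ , next≡ =
  [] , s ∷ S , S , xs≡ , ins≡ , trans (++-identityʳ (s ∷ S)) (cong (_∷ S) (just-injective (sym next≡)))
... | _ ∷ P , [] , xs≡ , ins≡ , next≡ with refl ← ∷-injectiveˡ xs≡ =
  x ∷ P , [] , P , xs≡ , ins≡ , cong (_∷ P) (just-injective (sym next≡))
... | _ ∷ P , s ∷ S , xs≡ , ins≡ , next≡ with refl ← ∷-injectiveˡ xs≡ =
  x ∷ P , s ∷ S , S ++ x ∷ P , xs≡ , ins≡ , cong (_∷ S ++ x ∷ P) (just-injective (sym next≡))

order-grow : ∀ T k → order (grow T k) ≡ 2 + order T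
order-grow T k = length-insertAfter (boundary T) k _ _

order-even : ∀ T → ∃[ m ] order T ≡ 2 * suc m
order-even base = 1 , refl
order-even (grow T k) with m , order≡ ← order-even T = suc m , (begin
  order (grow T k)  ≡⟨ order-grow T k ⟩
  2 + order T       ≡⟨ cong (2 +_) order≡ ⟩
  2 + 2 * suc m     ≡⟨ *-suc 2 (suc m) ⟨
  2 * suc (suc m)   ∎)
  where open ≡-Reasoning

order≥2 : ∀ T → 2 ≤ order T
order≥2 T with m , order≡ ← order-even T =
  ≤-trans (*-monoʳ-≤ 2 (s≤s z≤n)) (≤-reflexive (sym order≡))

EdgesBelow : ℕ → Tet → Set
EdgesBelow n T = All (λ e → proj₁ e < n × proj₂ e < n) (edges T)

Adj-below : ∀ {T n} → EdgesBelow n T → ∀ {p q} → Adj T p q → q < n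
Adj-below below (inj₁ pq∈) = proj₂ (All.lookup below pq∈)
Adj-below below (inj₂ qp∈) = proj₁ (All.lookup below qp∈)

Adj-grow : ∀ {T k p q} → Adj T p q → Adj (grow T k) p q
Adj-grow (inj₁ pq∈) = inj₁ (there (there (there pq∈)))
Adj-grow (inj₂ qp∈) = inj₂ (there (there (there qp∈)))

record Invariant (T : Tet) : Set where
  field
    boundary-below : All (_< order T) (boundary T)
    edges-below    : EdgesBelow (order T) T
    boundary-cycle : Cycle T (boundary T)
    boundary-paths : ArcPaths Between T (boundary T)

invariant-base : Invariant base
invariant-base = record
  { boundary-below = toWitness {a? = All.all? (_<? 4) (boundary base)} tt
  ; edges-below    = toWitness {a? = All.all? (λ e → proj₁ e <? 4 ×-dec proj₂ e <? 4) (edges base)} tt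
  ; boundary-cycle = cycle
  ; boundary-paths = ArcPaths-fromStrict 2 cycle refl no-strict
  }
  where
  cycle : Cycle base (boundary base)
  cycle = ( inj₁ (here refl) , inj₁ (there (here refl)) , inj₁ (there (there (here refl)))
          , inj₁ (there (there (there (here refl)))) , tt )
        , toWitness {a? = unique? (boundary base)} tt
  no-strict : ArcPaths StrictlyBetween base (boundary base)
  no-strict P u Q v S eq strictly = ⊥-elim (toWitnessFalse {a? = 6 ≤? 4} tt
    (≤-trans (strictlyBetween-sum strictly) (≤-reflexive (length-decomposition P Q S eq))))

invariant-grow : ∀ T k → Invariant T → Invariant (grow T k)
invariant-grow T k inv
  with m , order≡ ← order-even T
     | P , S , Mid , B≡ , B′≡ , SP≡
         ← insertAfter-rotation (boundary T) k (order T) (suc (order T)) (order≥2 T)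
  = record
  { boundary-below = subst (λ N → All (_< N) (boundary (grow T k))) (sym (order-grow T k))
                       (unrotate All-rotation below′)
  ; edges-below    = subst (λ N → EdgesBelow N (grow T k)) (sym (order-grow T k)) edges-below′
  ; boundary-cycle = unrotate Cycle-rotation (Cycle-ear cycle)
  ; boundary-paths = unrotate ArcPaths-rotation
                       (ArcPaths-ear (rotate ArcPaths-rotation boundary-paths) (suc m) cycle
                          (rotate (length-rotation (2 * suc m)) order≡))
  }
  where
  open Invariant inv

  n α β : ℕ
  n = order T
  α = lookup (boundary T) k
  β = cycNext (boundary T) k

  rotate : ∀ {Φ} → RotationInvariant Φ → Φ (boundary T) → Φ (α ∷ β ∷ Mid)
  rotate {Φ} rot φ = subst Φ (cong (α ∷_) SP≡) (++-swap rot P (α ∷ S) (subst Φ B≡ φ))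

  unrotate : ∀ {Φ} → RotationInvariant Φ → Φ (α ∷ n ∷ suc n ∷ β ∷ Mid) → Φ (boundary (grow T k))
  unrotate {Φ} rot φ = subst Φ (sym B′≡)
    (++-swap rot (α ∷ n ∷ suc n ∷ S) P (subst Φ (cong (λ R → α ∷ n ∷ suc n ∷ R) (sym SP≡)) φ))

  cycle : Cycle T (α ∷ β ∷ Mid)
  cycle = rotate Cycle-rotation boundary-cycle

  cycle-below : All (_< n) (α ∷ β ∷ Mid)
  cycle-below = rotate All-rotation boundary-below

  open Ear {T} {grow T k} Adj-grow (inj₁ (here refl)) (inj₁ (there (here refl)))
           (inj₁ (there (there (here refl)))) (Adj-below edges-below) cycle-below

  raise : ∀ {p} → p < n → p < 2 + n
  raise = m<n⇒m<1+n ∘ m<n⇒m<1+n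

  below′ : All (_< 2 + n) (α ∷ n ∷ suc n ∷ β ∷ Mid)
  below′ = raise (All.head cycle-below) ∷ m<n⇒m<1+n (n<1+n n) ∷ n<1+n (suc n)
         ∷ All.map raise (All.tail cycle-below)

  edges-below′ : EdgesBelow (2 + n) (grow T k)
  edges-below′ = (raise (All.head cycle-below) , m<n⇒m<1+n (n<1+n n))
               ∷ (m<n⇒m<1+n (n<1+n n) , n<1+n (suc n))
               ∷ (n<1+n (suc n) , raise (All.head (All.tail cycle-below)))
               ∷ All.map (λ { (p<n , q<n) → raise p<n , raise q<n }) edges-below

invariant : ∀ T → Invariant T
invariant base       = invariant-base
invariant (grow T k) = invariant-grow T k (invariant T)

lookup-split : ∀ (xs : List ℕ) i → ∃₂ λ P S → xs ≡ P ++ lookup xs i ∷ S × length P ≡ toℕ i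
lookup-split (x ∷ xs) zero    = [] , xs , refl , refl
lookup-split (x ∷ xs) (suc i) with P , S , xs≡ , length≡ ← lookup-split xs i =
  x ∷ P , S , cong (x ∷_) xs≡ , cong suc length≡

lookup-split₂ : ∀ (xs : List ℕ) i j → toℕ i < toℕ j → ∃₂ λ P Q → ∃ λ S →
  xs ≡ P ++ lookup xs i ∷ Q ++ lookup xs j ∷ S × toℕ i + suc (length Q) ≡ toℕ j
lookup-split₂ (x ∷ xs) zero    (suc j) _ with Q , S , xs≡ , length≡ ← lookup-split xs j =
  [] , Q , S , cong (x ∷_) xs≡ , cong suc length≡
lookup-split₂ (x ∷ xs) (suc i) (suc j) i<j
  with P , Q , S , xs≡ , j≡ ← lookup-split₂ xs i j (s≤s⁻¹ i<j) =
  x ∷ P , Q , S , cong (x ∷_) xs≡ , cong suc j≡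

boundary-paths-ordered : ∀ T (i j : Fin (order T)) → toℕ i < toℕ j → ∀ {ℓ} →
  Between ∣ toℕ i - toℕ j ∣ (order T ∸ ∣ toℕ i - toℕ j ∣) ℓ →
  HasPath T (lookup (boundary T) i) (lookup (boundary T) j) ℓ
boundary-paths-ordered T i j i<j {ℓ} between
  with P , Q , S , B≡ , j≡ ← lookup-split₂ (boundary T) i j i<j =
  Invariant.boundary-paths (invariant T) P _ Q _ S B≡
    (subst₂ (λ a b → Between a b ℓ) inner≡ outer≡ between)
  where
  inner≡ : ∣ toℕ i - toℕ j ∣ ≡ suc (length Q)
  inner≡ = trans (cong (∣ toℕ i -_∣) (sym j≡)) (∣m-m+n∣≡n (toℕ i) (suc (length Q)))
  outer≡ : order T ∸ ∣ toℕ i - toℕ j ∣ ≡ suc (length (P ++ S))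
  outer≡ = trans (cong₂ _∸_ (sym (length-decomposition P Q S B≡)) inner≡)
                 (m+n∸m≡n (suc (length Q)) _)

boundary-paths : ∀ T (i j : Fin (order T)) → i ≢ j → ∀ {ℓ} →
  Between ∣ toℕ i - toℕ j ∣ (order T ∸ ∣ toℕ i - toℕ j ∣) ℓ →
  HasPath T (lookup (boundary T) i) (lookup (boundary T) j) ℓ
boundary-paths T i j i≢j {ℓ} between with <-cmp (toℕ i) (toℕ j)
... | tri< i<j _ _ = boundary-paths-ordered T i j i<j between
... | tri≈ _ i≡j _ = ⊥-elim (i≢j (toℕ-injective i≡j))
... | tri> _ _ j<i = HasPath-reverse (boundary-paths-ordered T j i j<i
  (subst (λ d → Between d (order T ∸ d) ℓ) (∣-∣-comm (toℕ i) (toℕ j)) between))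

mainTheorem10 : (T : Tet) (i j : Fin (order T)) → i ≢ j →
    (t : ℕ) → distBd T i j + 2 * t ≤ order T ∸ distBd T i j →
    HasPath T (lookup (boundary T) i) (lookup (boundary T) j) (distBd T i j + 2 * t)
mainTheorem10 T i j i≢j t h = boundary-paths T i j i≢j (between-distance t arc≤order h)
  where
  arc≤order : ∣ toℕ i - toℕ j ∣ ≤ order T
  arc≤order =
    ≤-trans (∣m-n∣≤m⊔n (toℕ i) (toℕ j)) (⊔-lub (<⇒≤ (toℕ<n i)) (<⇒≤ (toℕ<n j)))
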